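{- Let $n \ge 1$ and $w \in \mathfrak{S}_n$. Then the shadow set $\mathcal{S}(w)$ of $w$ satisfies $|\mathcal{S}(w)| = n - \mathrm{lis}(w)$.
   Context: $\mathfrak{S}_n$ is the symmetric group on $[n]=\{1,\dots,n\}$. $\mathrm{lis}(w)$ is the largest $k$ such that there are positions $i_1<\cdots<i_k$ with $w(i_1)<\cdots<w(i_k)$. Shadow lines: given a finite set $X$ of lattice points in which no two points share an $x$-coordinate or a $y$-coordinate, let $X_1 \subseteq X$ be the set of points of $X$ that are minimal for the componentwise order (no other point of $X$ has both coordinates smaller); list them as $(a_1,b_1),\dots,(a_r,b_r)$ with $a_1<\cdots<a_r$ (so $b_1>\cdots>b_r$). The first shadow line of $X$ is the staircase path (boundary of the union of the northeast quadrants of these points) consisting of a vertical ray going up from $(a_1,b_1)$, the segments joining consecutive points via the corners $(a_{t+1},b_t)$, and a horizontal ray going right from $(a_r,b_r)$; its northeast corners are the points $(a_{t+1},b_t)$ for $1\le t<r$. Removing $X_1$ and repeating gives the second shadow line, and so on until all points are used. The shadow set $\mathcal{S}(X)$ is the set of all northeast corners of all shadow lines of $X$. For $w\in\mathfrak{S}_n$, $\mathcal{S}(w)$ is the shadow set of the graph $\{(i,w(i)) : 1\le i\le n\}$. -}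

module Defs where

open import Data.Nat using (ℕ; zero; suc; _<_; _<?_)
open import Data.Nat.Properties using (_≟_)
open import Data.Fin as Fin using (Fin; toℕ)
open import Data.Fin.Permutation using (Permutation′; _⟨$⟩ʳ_)
open import Data.List using (List; []; _∷_; map; filter; length; deduplicate; allFin; _++_)
open import Data.List.Relation.Unary.Any using (any?)
open import Data.Product using (_×_; _,_; proj₁; proj₂; Σ)
open import Data.Product.Properties using (≡-dec)
open import Relation.Nullary using (¬?)
open import Relation.Nullary.Decidable using (_×-dec_)
open import Relation.Binary.PropositionalEquality using (_≡_)

Point : Set
Point = ℕ × ℕ

_≺_ : Point → Point → Set
q ≺ p = (proj₁ q < proj₁ p) × (proj₂ q < proj₂ p)

_≺?_ : (q p : Point) → Relation.Nullary.Dec (q ≺ p)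
q ≺? p = (proj₁ q <? proj₁ p) ×-dec (proj₂ q <? proj₂ p)

minimals : List Point → List Point
minimals X = filter (λ p → ¬? (any? (λ q → q ≺? p) X)) X

nonMinimals : List Point → List Point
nonMinimals X = filter (λ p → any? (λ q → q ≺? p) X) X

-- Northeast corners of the staircase through (a₁,b₁),…,(a_r,b_r)
-- (listed with increasing a): the points (a_{t+1}, b_t), 1 ≤ t < r.
corners : List Point → List Point
corners [] = []
corners (p ∷ []) = []
corners (p ∷ q ∷ ps) = (proj₁ q , proj₂ p) ∷ corners (q ∷ ps)

-- Corners of all shadow lines, peeling off at most `fuel` shadow lines.
-- For a point set of size n, n rounds suffice (each round removes ≥ 1 point).
shadowCorners : ℕ → List Point → List Point
shadowCorners zero X = []
shadowCorners (suc fuel) X = corners (minimals X) ++ shadowCorners fuel (nonMinimals X)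

graph : ∀ {n} → Permutation′ n → List Point
graph {n} w = map (λ i → (suc (toℕ i) , suc (toℕ (w ⟨$⟩ʳ i)))) (allFin n)

shadowSet : ∀ {n} → Permutation′ n → List Point
shadowSet {n} w = deduplicate (≡-dec _≟_ _≟_) (shadowCorners n (graph w))

shadowSize : ∀ {n} → Permutation′ n → ℕ
shadowSize w = length (shadowSet w)

HasIncSubseq : ∀ {n} → Permutation′ n → ℕ → Set
HasIncSubseq {n} w k =
  Σ (Fin k → Fin n) λ f →
    ∀ (a b : Fin k) → a Fin.< b → (f a Fin.< f b) × ((w ⟨$⟩ʳ f a) Fin.< (w ⟨$⟩ʳ f b))

IsLis : ∀ {n} → Permutation′ n → ℕ → Set
IsLis w k = HasIncSubseq w k × (∀ m → HasIncSubseq w m → m Data.Nat.≤ k)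

{-# OPTIONS --safe #-}
module Submission where

-- Peeling off the minimal points lowers the height (the length of a longest chain for the strict
-- componentwise order) by exactly one: the bottom of a longest chain is minimal, its tail consists of
-- non-minimal points, and every chain of non-minimal points extends downwards. So a permutation graph
-- has lis(w) shadow lines, and a line through r points has r − 1 corners, giving n − lis(w) corners.
-- They are pairwise distinct because their abscissae are: the corners of a shadow line take the
-- abscissae of its points other than the first, and no two points of the graph share an abscissa.

open import Defs
open import Data.Nat using (ℕ; _≤_; _∸_)
open import Data.Fin.Permutation using (Permutation′)
open import Relation.Binary.PropositionalEquality using (_≡_)

open import Data.Nat using (zero; suc; _+_; z≤n; s≤s; s≤s⁻¹)
open import Data.Nat.Properties using (_≟_; +-assoc; +-suc; <-trans; ≤-reflexive; m∸n+n≡m; m+n∸n≡m; suc-injective; n≮n; ≤-trans; +-monoˡ-≤)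
open import Data.Fin as Fin using (Fin; toℕ)
open import Data.Fin.Properties using (toℕ-injective)
open import Data.Fin.Permutation using (_⟨$⟩ʳ_)
open import Data.List using (List; []; _∷_; map; filter; length; deduplicate; allFin; _++_; drop; tabulate; lookup)
open import Data.List.Properties using (length-map; length-++; length-tabulate; map-++; filter-all)
open import Data.List.Relation.Unary.All as All using (All; []; _∷_)
import Data.List.Relation.Unary.All.Properties as All
open import Data.List.Relation.Unary.Any using (Any; any?)
open import Data.List.Relation.Unary.AllPairs as AllPairs using (AllPairs; []; _∷_)
import Data.List.Relation.Unary.AllPairs.Properties as AllPairs
open import Data.List.Relation.Unary.Unique.Propositional using (Unique)
import Data.List.Relation.Unary.Unique.Propositional.Properties as Unique
open import Data.List.Relation.Binary.Disjoint.Propositional using (Disjoint)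
open import Data.List.Relation.Binary.Subset.Propositional using (_⊆_)
import Data.List.Relation.Binary.Subset.Propositional.Properties as Subset
import Data.List.Relation.Binary.Sublist.Propositional.Properties as Sublist
open import Data.List.Membership.Propositional using (_∈_; find; lose)
open import Data.List.Membership.Propositional.Properties using (∈-filter⁺; ∈-filter⁻; ∈-map⁺; ∈-map⁻; ∈-allFin; ∈-lookup; ∈-++⁻; ∈-length)
open import Data.Product using (_×_; _,_; proj₁; proj₂; Σ; ∃)
open import Data.Product.Properties using (≡-dec)
open import Data.Sum using (inj₁; inj₂)
open import Data.Empty using (⊥-elim)
open import Function using (_∘_)
open import Relation.Nullary using (¬_; ¬?; yes; no)
open import Relation.Unary using (Decidable)
open import Relation.Binary.Definitions using (Transitive; DecidableEquality)
open import Relation.Binary.PropositionalEquality using (refl; sym; trans; cong; subst; module ≡-Reasoning)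

module _ {A : Set} where

  length-filter-∁+filter : {P : A → Set} (P? : Decidable P) (xs : List A) →
    length (filter (¬? ∘ P?) xs) + length (filter P? xs) ≡ length xs
  length-filter-∁+filter P? [] = refl
  length-filter-∁+filter P? (x ∷ xs) with P? x
  ... | yes _ = trans (+-suc _ _) (cong suc (length-filter-∁+filter P? xs))
  ... | no  _ = cong suc (length-filter-∁+filter P? xs)

  AllPairs-lookup : ∀ {R : A → A → Set} {xs} → AllPairs R xs →
    ∀ {i j} → i Fin.< j → R (lookup xs i) (lookup xs j)
  AllPairs-lookup (Rx ∷ _)  {Fin.zero}  {Fin.suc j} _       = All.lookup Rx (∈-lookup j)
  AllPairs-lookup (_ ∷ Rxs) {Fin.suc i} {Fin.suc j} (s≤s i<j) = AllPairs-lookup Rxs i<j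

  deduplicate-Unique : (_≟_ : DecidableEquality A) {xs : List A} →
    Unique xs → deduplicate _≟_ xs ≡ xs
  deduplicate-Unique _≟_ [] = refl
  deduplicate-Unique _≟_ {x ∷ xs} (x∉xs ∷ xs!) rewrite deduplicate-Unique _≟_ xs! =
    cong (x ∷_) (filter-all (¬? ∘ (x ≟_)) x∉xs)

module _ {A B : Set} {f : A → B} where

  Unique-map-injective : ∀ {xs x y} → Unique (map f xs) → x ∈ xs → y ∈ xs → f x ≡ f y → x ≡ y
  Unique-map-injective _          (Any.here refl) (Any.here refl) _  = refl
  Unique-map-injective (fx∉ ∷ _)  (Any.here refl) (Any.there y∈) fx≡fy =
    ⊥-elim (All.lookup fx∉ (∈-map⁺ f y∈) fx≡fy)
  Unique-map-injective (fy∉ ∷ _)  (Any.there x∈) (Any.here refl) fx≡fy =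
    ⊥-elim (All.lookup fy∉ (∈-map⁺ f x∈) (sym fx≡fy))
  Unique-map-injective (_ ∷ fxs!) (Any.there x∈) (Any.there y∈) fx≡fy =
    Unique-map-injective fxs! x∈ y∈ fx≡fy

  Unique-map-filter : {P : A → Set} (P? : Decidable P) {xs : List A} →
    Unique (map f xs) → Unique (map f (filter P? xs))
  Unique-map-filter P? = AllPairs.map⁺ ∘ AllPairs.filter⁺ P? ∘ AllPairs.map⁻

  All∈map⇒map : ∀ {xs ys} → All (_∈ map f xs) ys → Σ (List A) λ zs → map f zs ≡ ys
  All∈map⇒map [] = [] , refl
  All∈map⇒map (y∈ ∷ ys∈) with ∈-map⁻ f y∈ | All∈map⇒map ys∈
  ... | z , _ , refl | zs , refl = z ∷ zs , refl

≺-trans : Transitive _≺_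
≺-trans (x₁<y₁ , x₂<y₂) (y₁<z₁ , y₂<z₂) = <-trans x₁<y₁ y₁<z₁ , <-trans x₂<y₂ y₂<z₂

Chain : List Point → List Point → Set
Chain X c = All (_∈ X) c × AllPairs _≺_ c

record Height (X : List Point) (r : ℕ) : Set where
  field
    longest : Σ (List Point) λ c → Chain X c × length c ≡ r
    maximal : ∀ {c} → Chain X c → length c ≤ r

module _ {X : List Point} where

  Dominated : Point → Set
  Dominated p = Any (_≺ p) X

  dominated? : Decidable Dominated
  dominated? p = any? (_≺? p) X

  ∈-minimals⁺ : ∀ {p} → p ∈ X → ¬ Dominated p → p ∈ minimals X
  ∈-minimals⁺ = ∈-filter⁺ (¬? ∘ dominated?)

  ∈-minimals⁻ : ∀ {p} → p ∈ minimals X → p ∈ X × ¬ Dominated p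
  ∈-minimals⁻ = ∈-filter⁻ (¬? ∘ dominated?)

  ∈-nonMinimals⁺ : ∀ {p} → p ∈ X → Dominated p → p ∈ nonMinimals X
  ∈-nonMinimals⁺ = ∈-filter⁺ dominated?

  ∈-nonMinimals⁻ : ∀ {p} → p ∈ nonMinimals X → p ∈ X × Dominated p
  ∈-nonMinimals⁻ = ∈-filter⁻ dominated?

  length-minimals+nonMinimals : length (minimals X) + length (nonMinimals X) ≡ length X
  length-minimals+nonMinimals = length-filter-∁+filter dominated? X

  Chain-∷ : ∀ {q p cs} → q ∈ X → q ≺ p → Chain X (p ∷ cs) → Chain X (q ∷ p ∷ cs)
  Chain-∷ q∈X q≺p (p∷cs∈X , p≺cs ∷ cs↑) = q∈X ∷ p∷cs∈X , (q≺p ∷ All.map (≺-trans q≺p) p≺cs) ∷ p≺cs ∷ cs↑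

  Chain-tail-nonMinimals : ∀ {p cs} → Chain X (p ∷ cs) → Chain (nonMinimals X) cs
  Chain-tail-nonMinimals (p∈X ∷ cs∈X , p≺cs ∷ cs↑) =
    All.zipWith (λ (e∈X , p≺e) → ∈-nonMinimals⁺ e∈X (lose p∈X p≺e)) (cs∈X , p≺cs) , cs↑

  Chain-extend-nonMinimals : ∀ {p cs} → Chain (nonMinimals X) (p ∷ cs) →
    ∃ λ q → Chain X (q ∷ p ∷ cs)
  Chain-extend-nonMinimals (cs∈N , cs↑) with ∈-nonMinimals⁻ (All.head cs∈N)
  ... | _ , p-dominated with find p-dominated
  ... | q , q∈X , q≺p = q , Chain-∷ q∈X q≺p (All.map (proj₁ ∘ ∈-nonMinimals⁻) cs∈N , cs↑)

  module _ {r} (h : Height X (suc r)) where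
    open Height h

    Height-nonMinimals : Height (nonMinimals X) r
    Height-nonMinimals with longest
    ... | _ ∷ cs , chain , refl = record
      { longest = cs , Chain-tail-nonMinimals chain , refl
      ; maximal = bounded
      }
      where
      bounded : ∀ {c} → Chain (nonMinimals X) c → length c ≤ length cs
      bounded {[]} _ = z≤n
      bounded {_ ∷ _} chain = s≤s⁻¹ (maximal (proj₂ (Chain-extend-nonMinimals chain)))

    Height⇒minimal : ∃ (_∈ minimals X)
    Height⇒minimal with longest
    ... | p ∷ _ , chain@(p∈X ∷ _ , _) , refl = p , ∈-minimals⁺ p∈X undominated
      where
      undominated : ¬ Dominated p
      undominated p-dominated =
        let q , q∈X , q≺p = find p-dominated
        in n≮n _ (maximal (Chain-∷ q∈X q≺p chain))

length-corners : ∀ L → length (corners L) ≡ length L ∸ 1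
length-corners [] = refl
length-corners (_ ∷ []) = refl
length-corners (_ ∷ q ∷ ps) = cong suc (length-corners (q ∷ ps))

map-proj₁-corners : ∀ L → map proj₁ (corners L) ≡ drop 1 (map proj₁ L)
map-proj₁-corners [] = refl
map-proj₁-corners (_ ∷ []) = refl
map-proj₁-corners (_ ∷ q ∷ ps) = cong (proj₁ q ∷_) (map-proj₁-corners (q ∷ ps))

shadowCorners-[] : ∀ f → shadowCorners f [] ≡ []
shadowCorners-[] zero = refl
shadowCorners-[] (suc f) = shadowCorners-[] f

length-shadowCorners : ∀ f {X r} → length X ≤ f → Height X r →
  length (shadowCorners f X) + r ≡ length X
length-shadowCorners f {[]} _ h with Height.longest h
... | [] , _ , refl rewrite shadowCorners-[] f = refl
... | _ ∷ _ , (() ∷ _ , _) , _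
length-shadowCorners zero {_ ∷ _} () _
length-shadowCorners (suc f) {_ ∷ _} {zero} _ h with Height.maximal h (Any.here refl ∷ [] , [] ∷ [])
... | ()
length-shadowCorners (suc f) {X@(_ ∷ _)} {suc r} |X|≤1+f h = begin
  length (corners M ++ shadowCorners f N) + suc r  ≡⟨ cong (_+ suc r) (length-++ (corners M)) ⟩
  length (corners M) + s + suc r                   ≡⟨ cong (λ l → l + s + suc r) (length-corners M) ⟩
  length M ∸ 1 + s + suc r                         ≡⟨ +-assoc (length M ∸ 1) s (suc r) ⟩
  length M ∸ 1 + (s + suc r)                       ≡⟨ cong (length M ∸ 1 +_) (+-suc s r) ⟩
  length M ∸ 1 + (1 + (s + r))                     ≡⟨ cong (λ l → length M ∸ 1 + (1 + l)) peeled ⟩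
  length M ∸ 1 + (1 + length N)                    ≡⟨ +-assoc (length M ∸ 1) 1 (length N) ⟨
  length M ∸ 1 + 1 + length N                      ≡⟨ cong (_+ length N) (m∸n+n≡m 1≤|M|) ⟩
  length M + length N                              ≡⟨ length-minimals+nonMinimals {X} ⟩
  length X                                         ∎
  where
  open ≡-Reasoning
  M N : List Point
  M = minimals X
  N = nonMinimals X
  s : ℕ
  s = length (shadowCorners f N)
  1≤|M| : 1 ≤ length M
  1≤|M| = ∈-length (proj₂ (Height⇒minimal {X} h))
  |N|<|X| : suc (length N) ≤ length X
  |N|<|X| = subst (suc (length N) ≤_) (length-minimals+nonMinimals {X}) (+-monoˡ-≤ (length N) 1≤|M|)
  peeled : s + r ≡ length N
  peeled = length-shadowCorners f (s≤s⁻¹ (≤-trans |N|<|X| |X|≤1+f)) (Height-nonMinimals {X} h)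

map-proj₁-corners-⊆ : ∀ L → map proj₁ (corners L) ⊆ map proj₁ L
map-proj₁-corners-⊆ L rewrite map-proj₁-corners L = Sublist.Any-resp-⊆ (Sublist.drop-⊆ 1 (map proj₁ L))

map-proj₁-shadowCorners-⊆ : ∀ f X → map proj₁ (shadowCorners f X) ⊆ map proj₁ X
map-proj₁-shadowCorners-⊆ zero X ()
map-proj₁-shadowCorners-⊆ (suc f) X x∈
  rewrite map-++ proj₁ (corners (minimals X)) (shadowCorners f (nonMinimals X))
  with ∈-++⁻ (map proj₁ (corners (minimals X))) x∈
... | inj₁ x∈corners =
  Subset.map⁺ proj₁ (Subset.filter-⊆ _ X) (map-proj₁-corners-⊆ (minimals X) x∈corners)
... | inj₂ x∈rest =
  Subset.map⁺ proj₁ (Subset.filter-⊆ _ X) (map-proj₁-shadowCorners-⊆ f (nonMinimals X) x∈rest)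

Disjoint-minimals-nonMinimals : ∀ {X} → Unique (map proj₁ X) →
  Disjoint (map proj₁ (minimals X)) (map proj₁ (nonMinimals X))
Disjoint-minimals-nonMinimals {X} distinct (x∈M , x∈N) with ∈-map⁻ proj₁ x∈M | ∈-map⁻ proj₁ x∈N
... | p , p∈M , refl | q , q∈N , p₁≡q₁ with ∈-minimals⁻ p∈M | ∈-nonMinimals⁻ q∈N
... | p∈X , p-undominated | q∈X , q-dominated =
  p-undominated (subst (Dominated {X}) (sym (Unique-map-injective distinct p∈X q∈X p₁≡q₁)) q-dominated)

Unique-shadowCorners : ∀ f {X} → Unique (map proj₁ X) → Unique (map proj₁ (shadowCorners f X))
Unique-shadowCorners zero _ = []
Unique-shadowCorners (suc f) {X} distinct
  rewrite map-++ proj₁ (corners (minimals X)) (shadowCorners f (nonMinimals X)) =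
  Unique.++⁺ cornersDistinct (Unique-shadowCorners f (Unique-map-filter (dominated? {X}) distinct)) disjoint
  where
  cornersDistinct : Unique (map proj₁ (corners (minimals X)))
  cornersDistinct rewrite map-proj₁-corners (minimals X) =
    Unique.drop⁺ 1 (Unique-map-filter (¬? ∘ dominated? {X}) distinct)
  disjoint : Disjoint (map proj₁ (corners (minimals X))) (map proj₁ (shadowCorners f (nonMinimals X)))
  disjoint (x∈corners , x∈rest) = Disjoint-minimals-nonMinimals distinct
    (map-proj₁-corners-⊆ (minimals X) x∈corners , map-proj₁-shadowCorners-⊆ f (nonMinimals X) x∈rest)

module _ {n} (w : Permutation′ n) where

  private
    point : Fin n → Point
    point i = suc (toℕ i) , suc (toℕ (w ⟨$⟩ʳ i))

  length-graph : length (graph w) ≡ n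
  length-graph = trans (length-map point (allFin n)) (length-tabulate (λ i → i))

  Unique-map-proj₁-graph : Unique (map proj₁ (graph w))
  Unique-map-proj₁-graph =
    AllPairs.map⁺ (AllPairs.map⁺ (AllPairs.map (λ i≢j → i≢j ∘ toℕ-injective ∘ suc-injective) (Unique.allFin⁺ n)))

  HasIncSubseq⇒Chain : ∀ {k} → HasIncSubseq w k →
    Σ (List Point) λ c → Chain (graph w) c × length c ≡ k
  HasIncSubseq⇒Chain (f , increasing) =
    tabulate (point ∘ f) ,
    (All.tabulate⁺ (λ a → ∈-map⁺ point (∈-allFin (f a))) ,
     AllPairs.tabulate⁺-< (λ a<b → s≤s (proj₁ (increasing _ _ a<b)) , s≤s (proj₂ (increasing _ _ a<b)))) ,
    length-tabulate _

  Chain⇒HasIncSubseq : ∀ {c} → Chain (graph w) c → HasIncSubseq w (length c)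
  Chain⇒HasIncSubseq (c∈graph , c↑) with All∈map⇒map c∈graph
  ... | d , refl = subst (HasIncSubseq w) (sym (length-map point d)) (lookup d , increasing)
    where
    increasing : ∀ a b → a Fin.< b →
      (lookup d a Fin.< lookup d b) × ((w ⟨$⟩ʳ lookup d a) Fin.< (w ⟨$⟩ʳ lookup d b))
    increasing a b a<b with AllPairs-lookup (AllPairs.map⁻ c↑) a<b
    ... | s≤s i<j , s≤s wi<wj = i<j , wi<wj

  Height-graph : ∀ {k} → IsLis w k → Height (graph w) k
  Height-graph (hasIncSubseq , lis-maximal) = record
    { longest = HasIncSubseq⇒Chain hasIncSubseq
    ; maximal = λ chain → lis-maximal _ (Chain⇒HasIncSubseq chain)
    }

lemma3p5 : (n : ℕ) → 1 ≤ n → (w : Permutation′ n) → (k : ℕ) → IsLis w k →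
    shadowSize w ≡ n ∸ k
lemma3p5 n _ w k lis = begin
  length (deduplicate _≟ₚ_ S)  ≡⟨ cong length (deduplicate-Unique _≟ₚ_ distinct) ⟩
  length S                     ≡⟨ m+n∸n≡m (length S) k ⟨
  length S + k ∸ k             ≡⟨ cong (_∸ k) counted ⟩
  length (graph w) ∸ k         ≡⟨ cong (_∸ k) (length-graph w) ⟩
  n ∸ k                        ∎
  where
  open ≡-Reasoning
  _≟ₚ_ : DecidableEquality Point
  _≟ₚ_ = ≡-dec _≟_ _≟_
  S : List Point
  S = shadowCorners n (graph w)
  distinct : Unique S
  distinct = Unique.map⁻ (Unique-shadowCorners n (Unique-map-proj₁-graph w))
  counted : length S + k ≡ length (graph w)
  counted = length-shadowCorners n (≤-reflexive (length-graph w)) (Height-graph w lis)
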